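{- Let $I$ be an instance of RAO with time budget $T$, lengths $t_i$, hints $h_i$ and non-increasing information rates $c_i:[t_i]\to[h_i]$ ($i\in[n]$), and let $g\in(0,1]$. Define the cut instance $I'_g$ with time budget $T'=T$, lengths $t'_i=\min\{t_i,gT\}$, hints $h'_i=h_i$ and information rates $c'_i:[t'_i]\to[h'_i]$ given by $c'_i(j)=c_i(j)$ for $1\le j\le t'_i$. Then $\mathrm{Opt}_{\mathrm{KPH}}(I)\le \mathrm{Opt}_{\mathrm{KPH}}(I'_g)/g$.
   Context: Notation: $[m]=\{1,\dots,m\}$. An RAO instance consists of a time budget $T$ and, for each article $i\in[n]$, a hint $h_i$, a length $t_i$ and an information rate $c_i:[t_i]\to[h_i]$. Knapsack Problem for Hints (KPH) of an instance: the fractional knapsack problem with item values $t_ih_i$, weights $t_i$ and capacity $T$, i.e. maximize $\sum_i t_ih_iy(i)$ subject to $\sum_it_iy(i)\le T$, $y(i)\in[0,1]$; $\mathrm{Opt}_{\mathrm{KPH}}$ denotes its optimal value (for $I'_g$ computed with $t'_i,h'_i,T'$).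
   Formalization: The parameter g ranges over the rationals in (0,1], and the knapsack variables $y(i)$ take values in ℚ. -}

module Defs where

open import Data.Nat as ℕ using (ℕ; zero; suc)
open import Data.Fin using (Fin; zero; suc; toℕ)
open import Data.Product using (Σ; _×_; _,_)
open import Data.Integer using (+_)
open import Data.Rational using (ℚ; 0ℚ; 1ℚ; _+_; _*_; _≤_; _<_; _⊓_; _/_)

ℕ→ℚ : ℕ → ℚ
ℕ→ℚ n = + n / 1

Σℚ : (n : ℕ) → (Fin n → ℚ) → ℚ
Σℚ zero    f = 0ℚ
Σℚ (suc n) f = f zero + Σℚ n (λ i → f (suc i))

-- An RAO instance: n articles, time budget T, and for each article i
-- a hint h i, a length t i and an information rate c i : [t i] → [h i]
-- (Fin (t i) encodes positions 1..t i; values are constrained to 1..h i).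
record RAO : Set where
  field
    n : ℕ
    T : ℕ
    h : Fin n → ℕ
    t : Fin n → ℕ
    c : (i : Fin n) → Fin (t i) → ℕ
    c-range : (i : Fin n) (j : Fin (t i)) → 1 ℕ.≤ c i j × c i j ℕ.≤ h i

NonIncreasingRates : RAO → Set
NonIncreasingRates I = (i : Fin n) (j j' : Fin (t i)) →
  toℕ j ℕ.≤ toℕ j' → c i j' ℕ.≤ c i j
  where open RAO I

-- Data of a Knapsack Problem for Hints: capacity T, item weights t i and
-- hints h i (item values t i * h i).  Rational, since cut lengths min{t_i, gT}
-- need not be integers.
record KPHData : Set where
  field
    n : ℕ
    T : ℚ
    t : Fin n → ℚ
    h : Fin n → ℚ

module _ (K : KPHData) where
  open KPHData K

  Feasible : (Fin n → ℚ) → Set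
  Feasible y = ((i : Fin n) → (0ℚ ≤ y i) × (y i ≤ 1ℚ))
             × (Σℚ n (λ i → t i * y i) ≤ T)

  value : (Fin n → ℚ) → ℚ
  value y = Σℚ n (λ i → (t i * h i) * y i)

  IsOptKPH : ℚ → Set
  IsOptKPH v = Σ (Fin n → ℚ) (λ y → Feasible y × (value y ≡' v))
             × ((y : Fin n → ℚ) → Feasible y → value y ≤ v)
    where
    open import Relation.Binary.PropositionalEquality using () renaming (_≡_ to _≡'_)

KPH : RAO → KPHData
KPH I = record { n = n ; T = ℕ→ℚ T ; t = λ i → ℕ→ℚ (t i) ; h = λ i → ℕ→ℚ (h i) }
  where open RAO I

KPHcut : RAO → ℚ → KPHData
KPHcut I g = record { n = n ; T = ℕ→ℚ T
                    ; t = λ i → ℕ→ℚ (t i) ⊓ (g * ℕ→ℚ T)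
                    ; h = λ i → ℕ→ℚ (h i) }
  where open RAO I

-- An optimal fractional packing y of I becomes a feasible packing of I'_g
-- after every item's load t_i y_i is shrunk by the factor g: if t_i ≤ g T the
-- cut leaves the item unchanged and y'_i = g y_i; otherwise t'_i = g T ≥ g t_i y_i,
-- so y'_i = t_i y_i / T ≤ 1 does it.  Total weight and value are both scaled by g,
-- hence Opt_KPH(I'_g) ≥ g Opt_KPH(I).
module Submission where

open import Defs
open import Data.Rational using (ℚ; 0ℚ; 1ℚ; _*_; _≤_; _<_)
open import Data.Product using (_×_)

open import Data.Nat using (zero; suc)
open import Data.Fin using (Fin; zero; suc)
open import Data.Product using (Σ-syntax; _,_; proj₁; proj₂)
open import Data.Rational using (_+_; _⊓_; 1/_; Positive; NonZero; nonNegative; positive)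
open import Data.Rational.Properties
open import Data.Rational.Solver using (module +-*-Solver)
open import Relation.Nullary using (yes; no)
open import Relation.Binary.PropositionalEquality

open +-*-Solver

ℕ→ℚ-nonNeg : ∀ n → 0ℚ ≤ ℕ→ℚ n
ℕ→ℚ-nonNeg n = nonNegative⁻¹ (ℕ→ℚ n) {{normalize-nonNeg n 1}}

*-nonNeg : ∀ {p q} → 0ℚ ≤ p → 0ℚ ≤ q → 0ℚ ≤ p * q
*-nonNeg {p} {q} 0≤p 0≤q =
  nonNegative⁻¹ (p * q) {{nonNeg*nonNeg⇒nonNeg p {{nonNegative 0≤p}} q {{nonNegative 0≤q}}}}

p≤1⇒p*q≤q : ∀ {p q} → p ≤ 1ℚ → 0ℚ ≤ q → p * q ≤ q
p≤1⇒p*q≤q {p} {q} p≤1 0≤q =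
  subst (p * q ≤_) (*-identityˡ q) (*-monoʳ-≤-nonNeg q {{nonNegative 0≤q}} p≤1)

Σℚ-cong : ∀ n {f f′ : Fin n → ℚ} → (∀ i → f i ≡ f′ i) → Σℚ n f ≡ Σℚ n f′
Σℚ-cong zero    f≡f′ = refl
Σℚ-cong (suc n) f≡f′ = cong₂ _+_ (f≡f′ zero) (Σℚ-cong n (λ i → f≡f′ (suc i)))

*-distribˡ-Σℚ : ∀ n g (f : Fin n → ℚ) → g * Σℚ n f ≡ Σℚ n (λ i → g * f i)
*-distribˡ-Σℚ zero    g f = *-zeroʳ g
*-distribˡ-Σℚ (suc n) g f =
  trans (*-distribˡ-+ g (f zero) _) (cong (g * f zero +_) (*-distribˡ-Σℚ n g (λ i → f (suc i))))

Σℚ-nonNeg : ∀ n (f : Fin n → ℚ) → (∀ i → 0ℚ ≤ f i) → 0ℚ ≤ Σℚ n f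
Σℚ-nonNeg zero    f 0≤f = ≤-refl
Σℚ-nonNeg (suc n) f 0≤f =
  +-mono-≤ (0≤f zero) (Σℚ-nonNeg n (λ i → f (suc i)) (λ i → 0≤f (suc i)))

term≤Σℚ : ∀ n (f : Fin n → ℚ) → (∀ i → 0ℚ ≤ f i) → ∀ i → f i ≤ Σℚ n f
term≤Σℚ (suc n) f 0≤f zero =
  subst (_≤ Σℚ (suc n) f) (+-identityʳ (f zero))
    (+-monoʳ-≤ (f zero) (Σℚ-nonNeg n (λ i → f (suc i)) (λ i → 0≤f (suc i))))
term≤Σℚ (suc n) f 0≤f (suc i) =
  ≤-trans (term≤Σℚ n (λ i → f (suc i)) (λ i → 0≤f (suc i)) i)
    (subst (_≤ Σℚ (suc n) f) (+-identityˡ _) (+-monoˡ-≤ _ (0≤f zero)))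

cut-rescale : ∀ {t y T g} → 0ℚ ≤ t → 0ℚ ≤ y → y ≤ 1ℚ → t * y ≤ T → 0ℚ < g → g ≤ 1ℚ →
  Σ[ z ∈ ℚ ] (0ℚ ≤ z × z ≤ 1ℚ) × ((t ⊓ (g * T)) * z ≡ g * (t * y))
cut-rescale {t} {y} {T} {g} 0≤t 0≤y y≤1 ty≤T 0<g g≤1 with 0ℚ <? T | t ≤? g * T
... | _ | yes t≤gT =
  g * y , (*-nonNeg (<⇒≤ 0<g) 0≤y , ≤-trans (p≤1⇒p*q≤q g≤1 0≤y) y≤1) ,
  trans (cong (_* (g * y)) (p≤q⇒p⊓q≡p t≤gT))
    (solve 3 (λ t g y → t :* (g :* y) := g :* (t :* y)) refl t g y)
... | yes 0<T | no t≰gT =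
  t * y * T⁻¹ , (*-nonNeg 0≤ty (<⇒≤ (positive⁻¹ T⁻¹ {{1/pos⇒pos T}})) , ty*T⁻¹≤1) ,
  (begin
    (t ⊓ (g * T)) * (t * y * T⁻¹) ≡⟨ cong (_* (t * y * T⁻¹)) (p≥q⇒p⊓q≡q (<⇒≤ (≰⇒> t≰gT))) ⟩
    g * T * (t * y * T⁻¹)         ≡⟨ solve 4 (λ g T p T⁻¹ → g :* T :* (p :* T⁻¹) := g :* p :* (T :* T⁻¹))
                                           refl g T (t * y) T⁻¹ ⟩
    g * (t * y) * (T * T⁻¹)       ≡⟨ cong (g * (t * y) *_) (*-inverseʳ T) ⟩
    g * (t * y) * 1ℚ              ≡⟨ *-identityʳ _ ⟩
    g * (t * y)                   ∎)
  where
  open ≡-Reasoning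
  instance
    T-pos : Positive T
    T-pos = positive 0<T
    T-nonZero : NonZero T
    T-nonZero = pos⇒nonZero T
  T⁻¹ : ℚ
  T⁻¹ = 1/ T
  0≤ty : 0ℚ ≤ t * y
  0≤ty = *-nonNeg 0≤t 0≤y
  ty*T⁻¹≤1 : t * y * T⁻¹ ≤ 1ℚ
  ty*T⁻¹≤1 = subst (t * y * T⁻¹ ≤_) (*-inverseʳ T)
    (*-monoʳ-≤-nonNeg T⁻¹ {{nonNegative (<⇒≤ (positive⁻¹ T⁻¹ {{1/pos⇒pos T}}))}} ty≤T)
-- A nonpositive budget forces the load t y to be 0, so z = 0 works.
... | no 0≮T | no _ =
  0ℚ , (≤-refl , <⇒≤ (positive⁻¹ 1ℚ)) ,
  trans (*-zeroʳ (t ⊓ (g * T))) (trans (sym (*-zeroʳ g)) (cong (g *_) (sym ty≡0)))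
  where
  ty≡0 : t * y ≡ 0ℚ
  ty≡0 = ≤-antisym (≤-trans ty≤T (≮⇒≥ 0≮T)) (*-nonNeg 0≤t 0≤y)

-- cut (KPH I) g is definitionally KPHcut I g.
cut : KPHData → ℚ → KPHData
cut K g = record K { t = λ i → t i ⊓ (g * T) }
  where open KPHData K

module _ (K : KPHData) where
  open KPHData K

  cut-solution : (∀ i → 0ℚ ≤ t i) → ∀ {g} → 0ℚ < g → g ≤ 1ℚ →
    ∀ {y} → Feasible K y →
    Σ[ y′ ∈ (Fin n → ℚ) ] Feasible (cut K g) y′ × (value (cut K g) y′ ≡ g * value K y)
  cut-solution 0≤t {g} 0<g g≤1 {y} (y-bounds , y-weight) =
    y′ , ((λ i → proj₁ (proj₂ (rescaled i))) , y′-weight) , y′-value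
    where
    0≤ty : ∀ i → 0ℚ ≤ t i * y i
    0≤ty i = *-nonNeg (0≤t i) (proj₁ (y-bounds i))
    rescaled : ∀ i → Σ[ z ∈ ℚ ] (0ℚ ≤ z × z ≤ 1ℚ) × ((t i ⊓ (g * T)) * z ≡ g * (t i * y i))
    rescaled i = cut-rescale (0≤t i) (proj₁ (y-bounds i)) (proj₂ (y-bounds i))
      (≤-trans (term≤Σℚ n _ 0≤ty i) y-weight) 0<g g≤1
    y′ : Fin n → ℚ
    y′ i = proj₁ (rescaled i)
    t′ : Fin n → ℚ
    t′ i = t i ⊓ (g * T)
    load′ : ∀ i → t′ i * y′ i ≡ g * (t i * y i)
    load′ i = proj₂ (proj₂ (rescaled i))
    y′-weight : Σℚ n (λ i → t′ i * y′ i) ≤ T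
    y′-weight = begin
      Σℚ n (λ i → t′ i * y′ i)     ≡⟨ Σℚ-cong n load′ ⟩
      Σℚ n (λ i → g * (t i * y i)) ≡⟨ *-distribˡ-Σℚ n g _ ⟨
      g * Σℚ n (λ i → t i * y i)   ≤⟨ p≤1⇒p*q≤q g≤1 (Σℚ-nonNeg n _ 0≤ty) ⟩
      Σℚ n (λ i → t i * y i)       ≤⟨ y-weight ⟩
      T                            ∎
      where open ≤-Reasoning
    item-value : ∀ i → t′ i * h i * y′ i ≡ g * (t i * h i * y i)
    item-value i = begin
      t′ i * h i * y′ i       ≡⟨ solve 3 (λ a h z → a :* h :* z := h :* (a :* z)) refl (t′ i) (h i) (y′ i) ⟩
      h i * (t′ i * y′ i)     ≡⟨ cong (h i *_) (load′ i) ⟩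
      h i * (g * (t i * y i)) ≡⟨ solve 4 (λ h g t y → h :* (g :* (t :* y)) := g :* (t :* h :* y))
                                        refl (h i) g (t i) (y i) ⟩
      g * (t i * h i * y i)   ∎
      where open ≡-Reasoning
    y′-value : value (cut K g) y′ ≡ g * value K y
    y′-value = trans (Σℚ-cong n item-value) (sym (*-distribˡ-Σℚ n g _))

-- KPH sees only lengths, hints and budget.
lemma5 : (I : RAO) → NonIncreasingRates I →
    (g : ℚ) → 0ℚ < g → g ≤ 1ℚ →
    (opt opt' : ℚ) → IsOptKPH (KPH I) opt → IsOptKPH (KPHcut I g) opt' →
    g * opt ≤ opt'
lemma5 I _ g 0<g g≤1 _ opt' ((y , y-feasible , refl) , _) (_ , opt'-max) =
  let y′ , y′-feasible , y′-value =
        cut-solution (KPH I) (λ i → ℕ→ℚ-nonNeg (RAO.t I i)) 0<g g≤1 y-feasible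
  in subst (_≤ opt') y′-value (opt'-max y′ y′-feasible)
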